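{- Let $m$ be a positive integer and $\Gamma=\mathrm{Cay}(\mathbb{Z}_{2m},S)$ a circulant graph. Let $H$ and $K$ be nontrivial subgroups of $\mathbb{Z}_{2m}$ with $|K|$ even, let $K_o=K\setminus 2K$, and suppose that either (1) $S+H\subseteq S\cup(K_o+H)$ and $H\cap K_o=\emptyset$, or (2) $(S\setminus K_o)+H\subseteq S\cup K_o$, and either $|H|\ne 2$ or $4$ divides $|K|$. Let $L=K+H$ and $L_o=L\setminus 2L$. Then: (i) if $|H|$ is odd, then $(S\setminus L_o)+H=S\setminus L_o$; (ii) if $2$ divides $|H|$ but $4$ does not, and $m\notin H\setminus K_o$, then $|H|>2$ and $(S\setminus L_o)+2H=S\setminus L_o$; (iii) if $m\in H\setminus K_o$, then $\Gamma\cong\mathrm{Cay}(\mathbb{Z}_{2m},S+m)$; (iv) if $4$ divides $|H|$ and $m\notin H\setminus K_o$, then $\mathrm{Cay}\big(\mathbb{Z}_{2m},(S\setminus\{m\})+m\big)$ has an automorphism fixing $0$ but moving $m$.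
   Context: For an additive group $G$ and an inverse-closed subset $S\subseteq G\setminus\{0\}$, the Cayley graph $\mathrm{Cay}(G,S)$ has vertex set $G$, with $x\sim y$ iff $y-x\in S$. For subsets $A,B\subseteq G$ and $g\in G$: $A+B=\{a+b:a\in A,b\in B\}$, $A+g=\{a+g:a\in A\}$, $2A=\{2a:a\in A\}$. -}

module Defs where

open import Data.Nat as ℕ using (ℕ; zero; suc; NonZero; _%_)
open import Data.Nat.Properties using (m<m+n)
open import Data.Nat.DivMod using (m%n<n)
open import Data.Fin using (Fin; toℕ; fromℕ<)
open import Data.Fin.Subset using (Subset; _∈_; _∪_; ⋃; ⁅_⁆; ⊥)
open import Data.Vec using (tabulate; lookup)
open import Data.List using (List; map)
open import Data.List.Base using (allFin)
open import Data.Bool using (if_then_else_)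
open import Data.Product using (_×_; ∃)
open import Function.Bundles using (_⤖_; _⇔_; Bijection)
open import Relation.Binary.PropositionalEquality using (_≡_; _≢_)

module _ {n : ℕ} {{_ : NonZero n}} where

  0ₙ : Fin n
  0ₙ = fromℕ< (m%n<n 0 n)

  infixl 6 _⊕_ _⊖_
  _⊕_ : Fin n → Fin n → Fin n
  a ⊕ b = fromℕ< (m%n<n (toℕ a ℕ.+ toℕ b) n)

  ⊝_ : Fin n → Fin n
  ⊝ a = fromℕ< (m%n<n (n ℕ.∸ toℕ a) n)

  _⊖_ : Fin n → Fin n → Fin n
  a ⊖ b = a ⊕ (⊝ b)

  translate : Subset n → Fin n → Subset n
  translate A g = tabulate (λ x → lookup A (x ⊖ g))

  sumset : Subset n → Subset n → Subset n
  sumset A B = ⋃ (map (λ a → if lookup A a then translate B a else ⊥) (allFin n))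

  double : Subset n → Subset n
  double A = ⋃ (map (λ a → if lookup A a then ⁅ a ⊕ a ⁆ else ⊥) (allFin n))

  record IsSubgroup (H : Subset n) : Set where
    field
      0∈H  : 0ₙ ∈ H
      ⊕-closed : ∀ {x y} → x ∈ H → y ∈ H → (x ⊕ y) ∈ H
      ⊝-closed : ∀ {x} → x ∈ H → (⊝ x) ∈ H

  Nontrivial : Subset n → Set
  Nontrivial H = ∃ λ x → x ∈ H × x ≢ 0ₙ

  Adj : Subset n → Fin n → Fin n → Set
  Adj S x y = (y ⊖ x) ∈ S

  record CayIso (S T : Subset n) : Set where
    field
      f   : Fin n ⤖ Fin n
      adj : ∀ x y → Adj S x y ⇔ Adj T (Bijection.to f x) (Bijection.to f y)

  CayAut : Subset n → Set
  CayAut S = CayIso S S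

half : (m : ℕ) → {{NonZero m}} → Fin (m ℕ.+ m)
half (suc m) = fromℕ< (m<m+n (suc m) {suc m} (ℕ.s≤s ℕ.z≤n))

-- Subgroups of ℤ_n are cyclic, G = ⟨d⟩ with |G| d = n. Hence in ℤ_2m the element m lies in G iff
-- |G| is even and in 2G iff 4 ∣ |G|; if m ∉ G then G = 2G; and 2G has index at most 2 in G.
-- Lo = L ∖ 2L is a union of cosets of 2L, and either hypothesis gives (S ∖ Lo) + H ⊆ S ∪ Lo
-- (using Ko ⊆ Lo, which holds when m ∉ 2H). Since H ⊆ 2L for odd |H| and 2H ⊆ 2L always,
-- S ∖ Lo is a union of cosets of H, resp. 2H: this is (i) and (ii).
-- For (iii), x ↦ x + ε(x) m is an isomorphism Cay(S) ≅ Cay(S + m), where ε(x) says which of the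
-- two cosets of 2K in K (resp. of 2L in L) contains x - r(x), for r(x) a fixed representative of
-- x + K (resp. x + L): ε is unchanged by adding m ∈ 2K and flips when adding an element of Ko
-- (resp. of Ko + H).
-- For (iv), take h ∈ H with 2h = m: translating the coset m + 2K by h and m + h + 2K by -h, and
-- fixing all other vertices, is an automorphism of Cay((S ∖ {m}) + m) fixing 0 and moving m.

module Submission where

open import Defs

open import Algebra.Bundles using (AbelianGroup)
open import Algebra.Structures using (IsAbelianGroup)
open import Data.Bool using (Bool; true; false; not; _xor_; if_then_else_)
open import Data.Bool.Properties using (not-¬)
open import Data.Empty using (⊥-elim)
open import Data.Fin using (Fin; zero; suc; toℕ; fromℕ; fromℕ<)
open import Data.Fin.Properties using (_≟_; toℕ-fromℕ; toℕ-fromℕ<; toℕ-inject; toℕ-injective; toℕ<n; ¬∀⟶∃¬-smallest)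
open import Data.Fin.Subset using (Subset; _∈_; _∉_; _⊆_; _∪_; _∩_; _─_; ⋃; ⁅_⁆; ⊥; ∣_∣; Empty)
open import Data.Fin.Subset.Properties using (_∈?_; ⊆-antisym; p─q⊆p; ∉⊥; x∈⁅x⁆; x∈⁅y⁆⇒x≡y; x≢y⇒x∉⁅y⁆; x∈p∩q⁺; x∈p∩q⁻; x∈p∪q⁺; x∈p∪q⁻; x∈p∧x∉q⇒x∈p─q; x∈p⇒∣p-x∣<∣p∣)
open import Data.List using (List; []; _∷_; map; allFin)
open import Data.List.Membership.Propositional using () renaming (_∈_ to _∈ₗ_)
open import Data.List.Membership.Propositional.Properties using (∈-allFin)
open import Data.List.Relation.Unary.Any using (here; there)
open import Data.Nat using (ℕ; zero; suc; NonZero; pred; _+_; _*_; _∸_; _%_; _/_; _<_; _>_; z≤n; s≤s; s≤s⁻¹)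
open import Data.Nat.DivMod using (m%n<n; %-distribˡ-+; m*n%n≡0; [m+n]%n≡m%n; n%n≡0; m<n⇒m%n≡m; m≡m%n+[m/n]*n; m/n*n≡m; m∣n⇒o%n%m≡o%m; %-remove-+ʳ)
open import Data.Nat.Divisibility using (_∣_; divides; _∣?_; m%n≡0⇒n∣m; ∣⇒≤; n∣m*n; ∣n⇒∣m*n; ∣m+n∣m⇒∣n; %-presˡ-∣)
open import Data.Nat.Properties using (+-assoc; +-comm; +-identityʳ; +-suc; *-cancelʳ-≡; *-distribʳ-+; m+[n∸m]≡n; m<m+n; suc-pred; <⇒≤; <⇒≱; ≤-<-trans)
open import Data.Nat.Tactic.RingSolver using (solve-∀)
open import Data.Product using (_×_; _,_; proj₁; proj₂; ∃; ∃₂)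
open import Data.Sum using (_⊎_; inj₁; inj₂; [_,_]′)
open import Data.Vec using (_∷_; lookup; tabulate)
open import Data.Vec.Base using (here; there)
open import Data.Vec.Properties using ([]=⇒lookup; lookup⇒[]=; lookup∘tabulate; tabulate-cong)
open import Function using (_∘_)
open import Function.Bundles using (Bijection; Equivalence; _⇔_; mk⇔; mk↔ₛ′)
open import Function.Properties.Inverse using (↔⇒⤖)
open import Level using (0ℓ)
open import Relation.Binary.PropositionalEquality using (_≡_; _≢_; refl; sym; trans; cong; cong₂; subst; subst₂; isEquivalence; module ≡-Reasoning)
open import Relation.Nullary using (¬_; Dec; yes; no; does; ¬?)
open import Relation.Nullary.Decidable using (decidable-stable; dec-true; dec-false; does-⇔)

open ≡-Reasoning

module _ {n : ℕ} {{_ : NonZero n}} where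

  -- the residue class of a; by definition x ⊕ y = [ toℕ x + toℕ y ], ⊝ x = [ n ∸ toℕ x ], 0ₙ = [ 0 ]
  [_] : ℕ → Fin n
  [ a ] = fromℕ< (m%n<n a n)

  toℕ-[] : ∀ a → toℕ [ a ] ≡ a % n
  toℕ-[] a = toℕ-fromℕ< _

  []-cong-% : ∀ {a b} → a % n ≡ b % n → [ a ] ≡ [ b ]
  []-cong-% {a} {b} eq = toℕ-injective (trans (toℕ-[] a) (trans eq (sym (toℕ-[] b))))

  [toℕ] : ∀ x → [ toℕ x ] ≡ x
  [toℕ] x = toℕ-injective (trans (toℕ-[] (toℕ x)) (m<n⇒m%n≡m (toℕ<n x)))

  [n] : [ n ] ≡ 0ₙ
  [n] = []-cong-% (trans (n%n≡0 n) (sym (m*n%n≡0 0 n)))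

  [+] : ∀ a b → [ a ] ⊕ [ b ] ≡ [ a + b ]
  [+] a b = []-cong-% (begin
    (toℕ [ a ] + toℕ [ b ]) % n ≡⟨ cong₂ (λ u v → (u + v) % n) (toℕ-[] a) (toℕ-[] b) ⟩
    (a % n + b % n) % n         ≡⟨ %-distribˡ-+ a b n ⟨
    (a + b) % n                 ∎)

  ⊕-assoc : ∀ x y z → (x ⊕ y) ⊕ z ≡ x ⊕ (y ⊕ z)
  ⊕-assoc x y z = begin
    [ toℕ x + toℕ y ] ⊕ z          ≡⟨ cong ([ toℕ x + toℕ y ] ⊕_) ([toℕ] z) ⟨
    [ toℕ x + toℕ y ] ⊕ [ toℕ z ]  ≡⟨ [+] (toℕ x + toℕ y) (toℕ z) ⟩
    [ toℕ x + toℕ y + toℕ z ]      ≡⟨ cong [_] (+-assoc (toℕ x) (toℕ y) (toℕ z)) ⟩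
    [ toℕ x + (toℕ y + toℕ z) ]    ≡⟨ [+] (toℕ x) (toℕ y + toℕ z) ⟨
    [ toℕ x ] ⊕ (y ⊕ z)            ≡⟨ cong (_⊕ (y ⊕ z)) ([toℕ] x) ⟩
    x ⊕ (y ⊕ z)                    ∎

  ⊕-comm : ∀ x y → x ⊕ y ≡ y ⊕ x
  ⊕-comm x y = cong [_] (+-comm (toℕ x) (toℕ y))

  ⊕-identityʳ : ∀ x → x ⊕ 0ₙ ≡ x
  ⊕-identityʳ x = begin
    x ⊕ 0ₙ             ≡⟨ cong (_⊕ 0ₙ) ([toℕ] x) ⟨
    [ toℕ x ] ⊕ [ 0 ]  ≡⟨ [+] (toℕ x) 0 ⟩
    [ toℕ x + 0 ]      ≡⟨ cong [_] (+-identityʳ (toℕ x)) ⟩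
    [ toℕ x ]          ≡⟨ [toℕ] x ⟩
    x                  ∎

  ⊕-inverseʳ : ∀ x → x ⊕ (⊝ x) ≡ 0ₙ
  ⊕-inverseʳ x = begin
    x ⊕ (⊝ x)                  ≡⟨ cong (_⊕ (⊝ x)) ([toℕ] x) ⟨
    [ toℕ x ] ⊕ [ n ∸ toℕ x ]  ≡⟨ [+] (toℕ x) (n ∸ toℕ x) ⟩
    [ toℕ x + (n ∸ toℕ x) ]    ≡⟨ cong [_] (m+[n∸m]≡n (<⇒≤ (toℕ<n x))) ⟩
    [ n ]                      ≡⟨ [n] ⟩
    0ₙ                         ∎

  ⊕-isAbelianGroup : IsAbelianGroup _≡_ _⊕_ 0ₙ ⊝_
  ⊕-isAbelianGroup = record
    { isGroup = record
      { isMonoid = record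
        { isSemigroup = record
          { isMagma = record { isEquivalence = isEquivalence ; ∙-cong = cong₂ _⊕_ }
          ; assoc = ⊕-assoc }
        ; identity = (λ x → trans (⊕-comm 0ₙ x) (⊕-identityʳ x)) , ⊕-identityʳ }
      ; inverse = (λ x → trans (⊕-comm (⊝ x) x) (⊕-inverseʳ x)) , ⊕-inverseʳ
      ; ⁻¹-cong = cong ⊝_ }
    ; comm = ⊕-comm }

ℤ-abelianGroup : (n : ℕ) → {{NonZero n}} → AbelianGroup 0ℓ 0ℓ
ℤ-abelianGroup n = record { isAbelianGroup = ⊕-isAbelianGroup {n} }

module ℤ-Properties {n : ℕ} {{_ : NonZero n}} where
  open import Algebra.Properties.AbelianGroup (ℤ-abelianGroup n) public
  open import Algebra.Properties.CommutativeSemigroup (AbelianGroup.commutativeSemigroup (ℤ-abelianGroup n)) public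
    using (interchange; xy∙z≈xz∙y)
  open AbelianGroup (ℤ-abelianGroup n) public using (identityˡ; identityʳ; inverseʳ)

open ℤ-Properties

module _ {n : ℕ} {{_ : NonZero n}} where

  ⊕-⊖-interchange : ∀ (x y u v : Fin n) → (x ⊕ y) ⊖ (u ⊕ v) ≡ (x ⊖ u) ⊕ (y ⊖ v)
  ⊕-⊖-interchange x y u v = begin
    (x ⊕ y) ⊕ ⊝ (u ⊕ v)      ≡⟨ cong ((x ⊕ y) ⊕_) (⁻¹-∙-comm u v) ⟨
    (x ⊕ y) ⊕ (⊝ u ⊕ ⊝ v)    ≡⟨ interchange x y (⊝ u) (⊝ v) ⟩
    (x ⊖ u) ⊕ (y ⊖ v)        ∎

  ⊕-⊖-cancelʳ : ∀ (x y e : Fin n) → (x ⊕ e) ⊖ (y ⊕ e) ≡ x ⊖ y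
  ⊕-⊖-cancelʳ x y e = trans (⊕-⊖-interchange x e y e) (trans (cong ((x ⊖ y) ⊕_) (inverseʳ e)) (identityʳ (x ⊖ y)))

  ⊖-⊕-⊖ : ∀ (x y z : Fin n) → (x ⊖ y) ⊕ (y ⊖ z) ≡ x ⊖ z
  ⊖-⊕-⊖ x y z = trans (sym (⊕-assoc (x ⊖ y) y (⊝ z))) (cong (_⊖ z) (//-rightDividesˡ y x))

  ⊕≡⊕⇒⊖≡⊖ : ∀ {a b u v : Fin n} → a ⊕ b ≡ u ⊕ v → a ⊖ u ≡ v ⊖ b
  ⊕≡⊕⇒⊖≡⊖ {a} {b} {u} {v} a⊕b≡u⊕v = begin
    a ⊖ u                    ≡⟨ ⊕-⊖-cancelʳ a u b ⟨
    (a ⊕ b) ⊖ (u ⊕ b)        ≡⟨ cong (_⊖ (u ⊕ b)) a⊕b≡u⊕v ⟩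
    (u ⊕ v) ⊖ (u ⊕ b)        ≡⟨ ⊕-⊖-interchange u v u b ⟩
    (u ⊖ u) ⊕ (v ⊖ b)        ≡⟨ cong (_⊕ (v ⊖ b)) (inverseʳ u) ⟩
    0ₙ ⊕ (v ⊖ b)             ≡⟨ identityˡ (v ⊖ b) ⟩
    v ⊖ b                    ∎

x∈p─q⇒x∉q : ∀ {n} {x : Fin n} (p q : Subset n) → x ∈ p ─ q → x ∉ q
x∈p─q⇒x∉q {x = zero}  (_ ∷ p) (true ∷ q)  ()        here
x∈p─q⇒x∉q {x = suc x} (_ ∷ p) (_ ∷ q)     (there h) (there h') = x∈p─q⇒x∉q p q h h'

module _ {n : ℕ} where

  x∈p─q⁻ : ∀ {x : Fin n} (p q : Subset n) → x ∈ p ─ q → x ∈ p × x ∉ q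
  x∈p─q⁻ p q h = p─q⊆p p q h , x∈p─q⇒x∉q p q h

  x∈tabulate⁺ : ∀ {f : Fin n → Bool} {x} → f x ≡ true → x ∈ tabulate f
  x∈tabulate⁺ {f} {x} fx = lookup⇒[]= x _ (trans (lookup∘tabulate f x) fx)

  x∈tabulate⁻ : ∀ {f : Fin n → Bool} {x} → x ∈ tabulate f → f x ≡ true
  x∈tabulate⁻ {f} {x} h = trans (sym (lookup∘tabulate f x)) ([]=⇒lookup h)

  -- ⋃_{a ∈ A} F a; sumset and double of Defs are literally of this shape
  ⋃∈ : Subset n → (Fin n → Subset n) → Subset n
  ⋃∈ A F = ⋃ (map (λ a → if lookup A a then F a else ⊥) (allFin n))

  x∈⋃⁺ : ∀ (F : Fin n → Subset n) {x a} (as : List (Fin n)) → a ∈ₗ as → x ∈ F a → x ∈ ⋃ (map F as)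
  x∈⋃⁺ F (_ ∷ _)  (here refl) h = x∈p∪q⁺ (inj₁ h)
  x∈⋃⁺ F (_ ∷ as) (there a∈)  h = x∈p∪q⁺ (inj₂ (x∈⋃⁺ F as a∈ h))

  x∈⋃⁻ : ∀ (F : Fin n → Subset n) {x} (as : List (Fin n)) → x ∈ ⋃ (map F as) → ∃ λ a → x ∈ F a
  x∈⋃⁻ F []       h = ⊥-elim (∉⊥ h)
  x∈⋃⁻ F (a ∷ as) h with x∈p∪q⁻ (F a) _ h
  ... | inj₁ h₁ = a , h₁
  ... | inj₂ h₂ = x∈⋃⁻ F as h₂

  x∈⋃∈⁺ : ∀ {A F a x} → a ∈ A → x ∈ F a → x ∈ ⋃∈ A F
  x∈⋃∈⁺ {A} {F} {a} a∈A x∈Fa = x∈⋃⁺ _ (allFin n) (∈-allFin a) (select (lookup A a) ([]=⇒lookup a∈A))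
    where
    select : ∀ b → b ≡ true → _ ∈ (if b then F a else ⊥)
    select true refl = x∈Fa

  x∈⋃∈⁻ : ∀ {A F x} → x ∈ ⋃∈ A F → ∃ λ a → a ∈ A × x ∈ F a
  x∈⋃∈⁻ {A} {F} h with x∈⋃⁻ _ (allFin n) h
  ... | a , h' = a , select (lookup A a) refl h'
    where
    select : ∀ b → lookup A a ≡ b → _ ∈ (if b then F a else ⊥) → a ∈ A × _ ∈ F a
    select true  eq h = lookup⇒[]= a A eq , h
    select false _  h = ⊥-elim (∉⊥ h)

module _ {n : ℕ} {{_ : NonZero n}} where

  x∈translate⁺ : ∀ {A} g {x : Fin n} → x ⊖ g ∈ A → x ∈ translate A g
  x∈translate⁺ g = x∈tabulate⁺ ∘ []=⇒lookup

  x∈translate⁻ : ∀ {A} g {x : Fin n} → x ∈ translate A g → x ⊖ g ∈ A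
  x∈translate⁻ {A} g {x} = lookup⇒[]= (x ⊖ g) A ∘ x∈tabulate⁻

  a⊕b∈sumset : ∀ {A B} {a b : Fin n} → a ∈ A → b ∈ B → a ⊕ b ∈ sumset A B
  a⊕b∈sumset {a = a} {b} a∈A b∈B =
    x∈⋃∈⁺ a∈A (x∈translate⁺ a (subst (_∈ _) (sym (xyx⁻¹≈y a b)) b∈B))

  x∈sumset⁻ : ∀ A B {x : Fin n} → x ∈ sumset A B → ∃₂ λ a b → a ∈ A × b ∈ B × x ≡ a ⊕ b
  x∈sumset⁻ A B {x} h with x∈⋃∈⁻ h
  ... | a , a∈A , x∈B+a = a , x ⊖ a , a∈A , x∈translate⁻ a x∈B+a , trans (sym (//-rightDividesˡ a x)) (⊕-comm _ a)

  a⊕a∈double : ∀ {A} {a : Fin n} → a ∈ A → a ⊕ a ∈ double A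
  a⊕a∈double {a = a} a∈A = x∈⋃∈⁺ a∈A (x∈⁅x⁆ (a ⊕ a))

  x∈double⁻ : ∀ A {x : Fin n} → x ∈ double A → ∃ λ a → a ∈ A × x ≡ a ⊕ a
  x∈double⁻ A h with x∈⋃∈⁻ h
  ... | a , a∈A , x∈⁅2a⁆ = a , a∈A , x∈⁅y⁆⇒x≡y _ x∈⁅2a⁆

module _ {n : ℕ} {{_ : NonZero n}} where

  module _ {G : Subset n} (G-sg : IsSubgroup G) where
    open IsSubgroup G-sg

    ⊖-closed : ∀ {x y} → x ∈ G → y ∈ G → x ⊖ y ∈ G
    ⊖-closed x∈G y∈G = ⊕-closed x∈G (⊝-closed y∈G)

    ⊕-cancelʳ-∈ : ∀ {x y} → x ⊕ y ∈ G → y ∈ G → x ∈ G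
    ⊕-cancelʳ-∈ {x} {y} x⊕y∈G y∈G = subst (_∈ G) (//-rightDividesʳ y x) (⊖-closed x⊕y∈G y∈G)

    double⊆ : double G ⊆ G
    double⊆ x∈2G with x∈double⁻ G x∈2G
    ... | a , a∈G , refl = ⊕-closed a∈G a∈G

    double-isSubgroup : IsSubgroup (double G)
    double-isSubgroup = record
      { 0∈H      = subst (_∈ double G) (identityʳ 0ₙ) (a⊕a∈double 0∈H)
      ; ⊕-closed = closed
      ; ⊝-closed = inverse }
      where
      closed : ∀ {x y} → x ∈ double G → y ∈ double G → x ⊕ y ∈ double G
      closed x∈ y∈ with x∈double⁻ G x∈ | x∈double⁻ G y∈
      ... | a , a∈G , refl | b , b∈G , refl =
        subst (_∈ double G) (interchange a b a b) (a⊕a∈double (⊕-closed a∈G b∈G))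
      inverse : ∀ {x} → x ∈ double G → ⊝ x ∈ double G
      inverse x∈ with x∈double⁻ G x∈
      ... | a , a∈G , refl = subst (_∈ double G) (⁻¹-∙-comm a a) (a⊕a∈double (⊝-closed a∈G))

  ∩-isSubgroup : ∀ {A B : Subset n} → IsSubgroup A → IsSubgroup B → IsSubgroup (A ∩ B)
  ∩-isSubgroup {A} {B} A-sg B-sg = record
    { 0∈H      = x∈p∩q⁺ (A.0∈H , B.0∈H)
    ; ⊕-closed = λ x∈ y∈ → x∈p∩q⁺ (A.⊕-closed (proj₁ (x∈p∩q⁻ A B x∈)) (proj₁ (x∈p∩q⁻ A B y∈))
                                 , B.⊕-closed (proj₂ (x∈p∩q⁻ A B x∈)) (proj₂ (x∈p∩q⁻ A B y∈)))
    ; ⊝-closed = λ x∈ → x∈p∩q⁺ (A.⊝-closed (proj₁ (x∈p∩q⁻ A B x∈)) , B.⊝-closed (proj₂ (x∈p∩q⁻ A B x∈))) }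
    where
    module A = IsSubgroup A-sg
    module B = IsSubgroup B-sg

  sumset-isSubgroup : ∀ {A B : Subset n} → IsSubgroup A → IsSubgroup B → IsSubgroup (sumset A B)
  sumset-isSubgroup {A} {B} A-sg B-sg = record
    { 0∈H      = subst (_∈ sumset A B) (identityʳ 0ₙ) (a⊕b∈sumset A.0∈H B.0∈H)
    ; ⊕-closed = closed
    ; ⊝-closed = inverse }
    where
    module A = IsSubgroup A-sg
    module B = IsSubgroup B-sg
    closed : ∀ {x y} → x ∈ sumset A B → y ∈ sumset A B → x ⊕ y ∈ sumset A B
    closed x∈ y∈ with x∈sumset⁻ A B x∈ | x∈sumset⁻ A B y∈
    ... | a , b , a∈A , b∈B , refl | a′ , b′ , a′∈A , b′∈B , refl =
      subst (_∈ sumset A B) (interchange a a′ b b′) (a⊕b∈sumset (A.⊕-closed a∈A a′∈A) (B.⊕-closed b∈B b′∈B))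
    inverse : ∀ {x} → x ∈ sumset A B → ⊝ x ∈ sumset A B
    inverse x∈ with x∈sumset⁻ A B x∈
    ... | a , b , a∈A , b∈B , refl = subst (_∈ sumset A B) (⁻¹-∙-comm a b) (a⊕b∈sumset (A.⊝-closed a∈A) (B.⊝-closed b∈B))

  double-mono : ∀ {A B : Subset n} → A ⊆ B → double A ⊆ double B
  double-mono {A} A⊆B x∈2A with x∈double⁻ A x∈2A
  ... | a , a∈A , refl = a⊕a∈double (A⊆B a∈A)

  ⊆sumsetˡ : ∀ {A B : Subset n} → 0ₙ ∈ B → A ⊆ sumset A B
  ⊆sumsetˡ 0∈B {x} x∈A = subst (_∈ _) (identityʳ x) (a⊕b∈sumset x∈A 0∈B)

  ⊆sumsetʳ : ∀ {A B : Subset n} → 0ₙ ∈ A → B ⊆ sumset A B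
  ⊆sumsetʳ 0∈A {x} x∈B = subst (_∈ _) (identityˡ x) (a⊕b∈sumset 0∈A x∈B)

  x∈translate-⊕ : ∀ {A} g e {x : Fin n} → x ∈ translate A g → x ⊕ e ∈ translate A (g ⊕ e)
  x∈translate-⊕ {A} g e {x} x∈A+g = x∈translate⁺ (g ⊕ e) (subst (_∈ A) (sym (⊕-⊖-cancelʳ x g e)) (x∈translate⁻ g x∈A+g))

  x∈translate-⊕⁻ : ∀ {A} g e {x : Fin n} → x ⊕ e ∈ translate A (g ⊕ e) → x ∈ translate A g
  x∈translate-⊕⁻ {A} g e {x} x⊕e∈ = x∈translate⁺ g (subst (_∈ A) (⊕-⊖-cancelʳ x g e) (x∈translate⁻ (g ⊕ e) x⊕e∈))

  module _ {K : Subset n} (K-sg : IsSubgroup K) where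
    open IsSubgroup K-sg

    coset-step : ∀ g {x y} → y ⊖ x ∈ K → x ∈ translate K g → y ∈ translate K g
    coset-step g {x} {y} y⊖x∈K x∈K+g =
      x∈translate⁺ g (subst (_∈ K) (⊖-⊕-⊖ y x g) (⊕-closed y⊖x∈K (x∈translate⁻ g x∈K+g)))

    coset-difference : ∀ g {x y} → x ∈ translate K g → y ∈ translate K g → y ⊖ x ∈ K
    coset-difference g {x} {y} x∈K+g y∈K+g =
      subst (_∈ K) (⊖-⊕-⊖ y g x)
        (⊕-closed (x∈translate⁻ g y∈K+g) (subst (_∈ K) (⁻¹-anti-homo-// x g) (⊝-closed (x∈translate⁻ g x∈K+g))))

    0∈coset⇒∈ : ∀ g → 0ₙ ∈ translate K g → g ∈ K
    0∈coset⇒∈ g 0∈K+g = subst (_∈ K) (trans (cong ⊝_ (identityˡ (⊝ g))) (⁻¹-involutive g)) (⊝-closed (x∈translate⁻ g 0∈K+g))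

    ∈coset-self : ∀ g → g ∈ translate K g
    ∈coset-self g = x∈translate⁺ g (subst (_∈ K) (sym (inverseʳ g)) 0∈H)

  module _ {G : Subset n} (G-sg : IsSubgroup G) where
    open IsSubgroup G-sg
    private
      2G-sg = double-isSubgroup G-sg
      module 2G = IsSubgroup 2G-sg

    ─double-⊕ : ∀ {x y} → x ∈ G ─ double G → y ∈ double G → x ⊕ y ∈ G ─ double G
    ─double-⊕ {x} {y} x∈ y∈2G with x∈p─q⁻ G (double G) x∈
    ... | x∈G , x∉2G =
      x∈p∧x∉q⇒x∈p─q (⊕-closed x∈G (double⊆ G-sg y∈2G)) (λ x⊕y∈2G → x∉2G (⊕-cancelʳ-∈ 2G-sg x⊕y∈2G y∈2G))

    ─double-⊕⁻ : ∀ {x y} → x ⊕ y ∈ G ─ double G → y ∈ double G → x ∈ G ─ double G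
    ─double-⊕⁻ {x} {y} x⊕y∈ y∈2G = subst (_∈ G ─ double G) (//-rightDividesʳ y x) (─double-⊕ x⊕y∈ (2G.⊝-closed y∈2G))

    double∉⇒∉ : ∀ {x} → x ⊕ x ∉ G → x ∉ G
    double∉⇒∉ x⊕x∉G x∈G = x⊕x∉G (⊕-closed x∈G x∈G)

  sumset-─-stable : ∀ {S X B : Subset n} → 0ₙ ∈ B → (∀ {x b} → x ⊕ b ∈ X → b ∈ B → x ∈ X) →
                    (∀ {a b} → a ∈ S ─ X → b ∈ B → a ⊕ b ∈ S ∪ X) → sumset (S ─ X) B ≡ S ─ X
  sumset-─-stable {S} {X} {B} 0∈B X-cancel S+B⊆S∪X = ⊆-antisym ⊆S─X (⊆sumsetˡ 0∈B)
    where
    ⊆S─X : sumset (S ─ X) B ⊆ S ─ X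
    ⊆S─X x∈ with x∈sumset⁻ (S ─ X) B x∈
    ... | a , b , a∈S─X , b∈B , refl with x∈p─q⁻ S X a∈S─X | x∈p∪q⁻ S X (S+B⊆S∪X a∈S─X b∈B)
    ...   | _ , a∉X | inj₁ a⊕b∈S = x∈p∧x∉q⇒x∈p─q a⊕b∈S (λ a⊕b∈X → a∉X (X-cancel a⊕b∈X b∈B))
    ...   | _ , a∉X | inj₂ a⊕b∈X = ⊥-elim (a∉X (X-cancel a⊕b∈X b∈B))

-- Subgroups of ℤ_n are cyclic

least-positive : ∀ {P : ℕ → Set} → (∀ i → Dec (P i)) → ∀ N → P (suc N) →
                 ∃ λ d → P (suc d) × (∀ e → e < d → ¬ P (suc e))
least-positive {P} P? N PN
  with ¬∀⟶∃¬-smallest (suc N) (λ i → ¬ P (suc (toℕ i))) (λ i → ¬? (P? (suc (toℕ i))))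
         (λ none → none (fromℕ N) (subst (P ∘ suc) (sym (toℕ-fromℕ N)) PN))
... | i , ¬¬Pi , below = toℕ i , decidable-stable (P? _) ¬¬Pi , minimal
  where
  minimal : ∀ e → e < toℕ i → ¬ P (suc e)
  minimal e e<i = subst (¬_ ∘ P ∘ suc) (trans (toℕ-inject (fromℕ< e<i)) (toℕ-fromℕ< e<i)) (below (fromℕ< e<i))

module _ {n : ℕ} {{_ : NonZero n}} where

  record Cyclic (G : Subset n) : Set where
    field
      d       : ℕ
      {{d≢0}} : NonZero d
      d∣n     : d ∣ n
      ∈⇒∣     : ∀ {x} → x ∈ G → d ∣ toℕ x
      ∣⇒∈     : ∀ {x} → d ∣ toℕ x → x ∈ G

  module _ {G : Subset n} (G-sg : IsSubgroup G) where
    open IsSubgroup G-sg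

    [*]-closed : ∀ {d} → [ d ] ∈ G → ∀ j → [ j * d ] ∈ G
    [*]-closed d∈G zero    = 0∈H
    [*]-closed {d} d∈G (suc j) = subst (_∈ G) ([+] d (j * d)) (⊕-closed d∈G ([*]-closed d∈G j))

    [n]∈G : [ n ] ∈ G
    [n]∈G = subst (_∈ G) (sym [n]) 0∈H

    -- [ a % d ] = [ a ] ⊖ [ (a / d) * d ] is an element of G below d
    minimal⇒divides : ∀ {d} .{{_ : NonZero d}} → [ d ] ∈ G → (∀ r → suc r < d → [ suc r ] ∉ G) →
                      ∀ {a} → [ a ] ∈ G → d ∣ a
    minimal⇒divides {d} d∈G minimal {a} a∈G = m%n≡0⇒n∣m a d (residue-zero (a % d) refl)
      where
      residue∈G : [ a % d ] ∈ G
      residue∈G = ⊕-cancelʳ-∈ G-sg (subst (_∈ G) a≡ a∈G) ([*]-closed d∈G (a / d))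
        where a≡ = trans (cong [_] (m≡m%n+[m/n]*n a d)) (sym ([+] (a % d) (a / d * d)))
      residue-zero : ∀ r → a % d ≡ r → r ≡ 0
      residue-zero zero    _  = refl
      residue-zero (suc r) eq with () ← minimal r (subst (_< d) eq (m%n<n a d)) (subst (λ m → [ m ] ∈ G) eq residue∈G)

    -- opaque, so that the generator is only ever used through the Cyclic interface
    opaque
      isSubgroup⇒cyclic : Cyclic G
      isSubgroup⇒cyclic with least-positive (λ i → [ i ] ∈? G) (pred n) (subst (λ m → [ m ] ∈ G) (sym (suc-pred n)) [n]∈G)
      ... | e , d∈G , below = record
        { d   = suc e
        ; d∣n = d∣ [n]∈G
        ; ∈⇒∣ = λ {x} x∈G → d∣ (subst (_∈ G) (sym ([toℕ] x)) x∈G)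
        ; ∣⇒∈ = λ { {x} (divides j eq) → subst (_∈ G) (trans (cong [_] (sym eq)) ([toℕ] x)) ([*]-closed d∈G j) } }
        where
        d∣ : ∀ {a} → [ a ] ∈ G → suc e ∣ a
        d∣ = minimal⇒divides d∈G (λ r r<d → below r (s≤s⁻¹ r<d))

-- The order of a cyclic subgroup

does≡true⇒ : ∀ {A : Set} (a? : Dec A) → does a? ≡ true → A
does≡true⇒ (yes a) _ = a

countFrom : (ℕ → Bool) → ℕ → ℕ → ℕ
countFrom f k zero    = zero
countFrom f k (suc N) = if f k then suc (countFrom f (suc k) N) else countFrom f (suc k) N

∣tabulate∣≡countFrom : ∀ f N k → ∣ tabulate {n = N} (λ i → f (toℕ i + k)) ∣ ≡ countFrom f k N
∣tabulate∣≡countFrom f zero    k = refl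
∣tabulate∣≡countFrom f (suc N) k
  with f k | trans (cong (∣_∣ {n = N}) (tabulate-cong (λ i → cong f (sym (+-suc (toℕ i) k)))))
                   (∣tabulate∣≡countFrom f N (suc k))
... | true  | rest = cong suc rest
... | false | rest = rest

countFrom-+ : ∀ f k a b → countFrom f k (a + b) ≡ countFrom f k a + countFrom f (a + k) b
countFrom-+ f k zero    b = refl
countFrom-+ f k (suc a) b
  with f k | trans (countFrom-+ f (suc k) a b) (cong (λ j → countFrom f (suc k) a + countFrom f j b) (+-suc a k))
... | true  | rest = cong suc rest
... | false | rest = rest

countFrom-none : ∀ f k N → (∀ i → i < N → f (i + k) ≡ false) → countFrom f k N ≡ 0
countFrom-none f k zero    none = refl
countFrom-none f k (suc N) none rewrite none 0 (s≤s z≤n) =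
  countFrom-none f (suc k) N (λ i i<N → trans (cong f (+-suc i k)) (none (suc i) (s≤s i<N)))

divisibleBy : ℕ → ℕ → Bool
divisibleBy d i = does (d ∣? i)

countFrom-divisibleBy-block : ∀ d .{{_ : NonZero d}} j → countFrom (divisibleBy d) (j * d) d ≡ 1
countFrom-divisibleBy-block d@(suc e) j rewrite dec-true (d ∣? j * d) (n∣m*n j) =
  cong suc (countFrom-none (divisibleBy d) (suc (j * d)) e none)
  where
  none : ∀ i → i < e → divisibleBy d (i + suc (j * d)) ≡ false
  none i i<e = dec-false (d ∣? _) λ d∣ →
    <⇒≱ (s≤s i<e) (∣⇒≤ (∣m+n∣m⇒∣n (subst (d ∣_) (trans (+-suc i (j * d)) (+-comm (suc i) (j * d))) d∣) (n∣m*n j)))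

countFrom-divisibleBy : ∀ d .{{_ : NonZero d}} j q → countFrom (divisibleBy d) (j * d) (q * d) ≡ q
countFrom-divisibleBy d j zero    = refl
countFrom-divisibleBy d j (suc q) = begin
  countFrom (divisibleBy d) (j * d) (d + q * d)
    ≡⟨ countFrom-+ _ (j * d) d (q * d) ⟩
  countFrom (divisibleBy d) (j * d) d + countFrom (divisibleBy d) (suc j * d) (q * d)
    ≡⟨ cong₂ _+_ (countFrom-divisibleBy-block d j) (countFrom-divisibleBy d (suc j) q) ⟩
  suc q
    ∎

module _ {n : ℕ} {{_ : NonZero n}} {G : Subset n} (G-cyc : Cyclic G) where
  open Cyclic G-cyc

  ∣G∣≡n/d : ∣ G ∣ ≡ n / d
  ∣G∣≡n/d = begin
    ∣ G ∣                                                  ≡⟨ cong ∣_∣ G≡multiples ⟩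
    ∣ tabulate {n = n} (λ i → divisibleBy d (toℕ i + 0)) ∣  ≡⟨ ∣tabulate∣≡countFrom (divisibleBy d) n 0 ⟩
    countFrom (divisibleBy d) 0 n                          ≡⟨ cong (countFrom (divisibleBy d) 0) (m/n*n≡m d∣n) ⟨
    countFrom (divisibleBy d) 0 (n / d * d)                ≡⟨ countFrom-divisibleBy d 0 (n / d) ⟩
    n / d                                                  ∎
    where
    G≡multiples : G ≡ tabulate (λ i → divisibleBy d (toℕ i + 0))
    G≡multiples = ⊆-antisym
      (λ x∈G → x∈tabulate⁺ (dec-true (d ∣? _) (subst (d ∣_) (sym (+-identityʳ _)) (∈⇒∣ x∈G))))
      (λ x∈ → ∣⇒∈ (subst (d ∣_) (+-identityʳ _) (does≡true⇒ (d ∣? _) (x∈tabulate⁻ x∈))))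

t*d+t*d≡t*2*d : ∀ t d → t * d + t * d ≡ t * 2 * d
t*d+t*d≡t*2*d = solve-∀

¬2∣⇒%2≡1 : ∀ a → ¬ 2 ∣ a → a % 2 ≡ 1
¬2∣⇒%2≡1 a ¬2∣a with a % 2 in eq | m%n<n a 2
... | zero        | _              = ⊥-elim (¬2∣a (m%n≡0⇒n∣m a 2 eq))
... | suc zero    | _              = refl
... | suc (suc _) | s≤s (s≤s ())

odd+odd-even : ∀ {a b} → ¬ 2 ∣ a → ¬ 2 ∣ b → 2 ∣ a + b
odd+odd-even {a} {b} ¬2∣a ¬2∣b = m%n≡0⇒n∣m (a + b) 2 (begin
  (a + b) % 2          ≡⟨ %-distribˡ-+ a b 2 ⟩
  (a % 2 + b % 2) % 2  ≡⟨ cong₂ (λ u v → (u + v) % 2) (¬2∣⇒%2≡1 a ¬2∣a) (¬2∣⇒%2≡1 b ¬2∣b) ⟩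
  0                    ∎)

module CyclicSubgroup {n : ℕ} {{_ : NonZero n}} {G : Subset n} (G-sg : IsSubgroup G) where
  open Cyclic (isSubgroup⇒cyclic G-sg) public

  instance
    d≢0′ : NonZero d
    d≢0′ = d≢0

  ∣G∣*d≡n : ∣ G ∣ * d ≡ n
  ∣G∣*d≡n = trans (cong (_* d) (∣G∣≡n/d (isSubgroup⇒cyclic G-sg))) (m/n*n≡m d∣n)

  [*d]∈G : ∀ j → [ j * d ] ∈ G
  [*d]∈G j = ∣⇒∈ (subst (d ∣_) (sym (toℕ-[] (j * d))) (%-presˡ-∣ (n∣m*n j) d∣n))

  [even*d]∈double : ∀ {i} → 2 ∣ i → [ i * d ] ∈ double G
  [even*d]∈double (divides t refl) =
    subst (_∈ double G) (trans ([+] (t * d) (t * d)) (cong [_] (t*d+t*d≡t*2*d t d))) (a⊕a∈double ([*d]∈G t))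

  even-index⇒∈double : ∀ {x i} → toℕ x ≡ i * d → 2 ∣ i → x ∈ double G
  even-index⇒∈double {x} {i} x≡id 2∣i = subst (_∈ double G) (trans (cong [_] (sym x≡id)) ([toℕ] x)) ([even*d]∈double {i} 2∣i)

  ∈double⇒even-index : 2 ∣ ∣ G ∣ → ∀ {x i} → x ∈ double G → toℕ x ≡ i * d → 2 ∣ i
  ∈double⇒even-index 2∣q {x} {i} x∈2G x≡id with x∈double⁻ G x∈2G
  ... | a , a∈G , refl with ∈⇒∣ a∈G
  ...   | divides r a≡rd = ∣m+n∣m⇒∣n (subst (2 ∣_) 2r≡ (divides r (sym (r*2≡r+r r)))) (∣n⇒∣m*n c 2∣q)
    where
    c = (toℕ a + toℕ a) / n
    r*2≡r+r : ∀ r → r * 2 ≡ r + r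
    r*2≡r+r = solve-∀
    distrib : ∀ r d → (r + r) * d ≡ r * d + r * d
    distrib = solve-∀
    factor : ∀ i c q d → i * d + c * (q * d) ≡ (c * q + i) * d
    factor = solve-∀
    2r≡ : r + r ≡ c * ∣ G ∣ + i
    2r≡ = *-cancelʳ-≡ (r + r) (c * ∣ G ∣ + i) d (begin
      (r + r) * d                        ≡⟨ distrib r d ⟩
      r * d + r * d                      ≡⟨ cong₂ _+_ a≡rd a≡rd ⟨
      toℕ a + toℕ a                      ≡⟨ m≡m%n+[m/n]*n (toℕ a + toℕ a) n ⟩
      (toℕ a + toℕ a) % n + c * n        ≡⟨ cong₂ (λ u v → u + c * v) (trans (sym (toℕ-[] _)) x≡id) (sym ∣G∣*d≡n) ⟩
      i * d + c * (∣ G ∣ * d)            ≡⟨ factor i c ∣ G ∣ d ⟩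
      (c * ∣ G ∣ + i) * d                ∎)

  index-odd : ∀ {x i} → x ∉ double G → toℕ x ≡ i * d → ¬ 2 ∣ i
  index-odd {i = i} x∉2G x≡id 2∣i = x∉2G (even-index⇒∈double {i = i} x≡id 2∣i)

  index-two : ∀ {x y} → x ∈ G ─ double G → y ∈ G ─ double G → x ⊕ y ∈ double G
  index-two {x} {y} x∈ y∈ with x∈p─q⁻ G _ x∈ | x∈p─q⁻ G _ y∈
  ... | x∈G , x∉2G | y∈G , y∉2G with ∈⇒∣ x∈G | ∈⇒∣ y∈G
  ...   | divides i x≡id | divides j y≡jd =
    subst (_∈ double G) x⊕y≡ ([even*d]∈double {i + j} (odd+odd-even (index-odd {i = i} x∉2G x≡id) (index-odd {i = j} y∉2G y≡jd)))
    where
    x⊕y≡ : [ (i + j) * d ] ≡ x ⊕ y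
    x⊕y≡ = cong [_] (trans (*-distribʳ-+ d i j) (sym (cong₂ _+_ x≡id y≡jd)))

  odd-order⇒⊆double : ¬ 2 ∣ ∣ G ∣ → G ⊆ double G
  odd-order⇒⊆double odd {x} x∈G with ∈⇒∣ x∈G
  ... | divides i x≡id with 2 ∣? i
  ...   | yes 2∣i = even-index⇒∈double {i = i} x≡id 2∣i
  ...   | no ¬2∣i = subst (_∈ double G) x≡ ([even*d]∈double {i + ∣ G ∣} (odd+odd-even ¬2∣i odd))
    where
    -- adding the multiple |G| d = n of the modulus turns the odd index into an even one
    x≡ : [ (i + ∣ G ∣) * d ] ≡ x
    x≡ = begin
      [ (i + ∣ G ∣) * d ]     ≡⟨ cong [_] (trans (*-distribʳ-+ d i ∣ G ∣) (cong (i * d +_) ∣G∣*d≡n)) ⟩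
      [ i * d + n ]           ≡⟨ cong [_] (cong (_+ n) (sym x≡id)) ⟩
      [ toℕ x + n ]           ≡⟨ []-cong-% ([m+n]%n≡m%n (toℕ x) n) ⟩
      [ toℕ x ]               ≡⟨ [toℕ] x ⟩
      x                       ∎

even∧≢2⇒>2 : ∀ {q} → 2 ∣ q → 0 < q → q ≢ 2 → q > 2
even∧≢2⇒>2 (divides zero          refl) ()  _
even∧≢2⇒>2 (divides 1             refl) _   q≢2 = ⊥-elim (q≢2 refl)
even∧≢2⇒>2 (divides (suc (suc t)) refl) _   _   = s≤s (s≤s (s≤s z≤n))

toℕ-half : ∀ k → toℕ (half (suc k)) ≡ suc k
toℕ-half k = toℕ-fromℕ< (m<m+n (suc k) (s≤s z≤n))

module Half {n : ℕ} {{_ : NonZero n}} (z : Fin n) (z+z≡n : toℕ z + toℕ z ≡ n) where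
  z⊕z≡0 : z ⊕ z ≡ 0ₙ
  z⊕z≡0 = trans (cong [_] z+z≡n) [n]

  module _ {G : Subset n} (G-sg : IsSubgroup G) where
    open CyclicSubgroup G-sg

    z≡t*d⇒∣G∣≡t*2 : ∀ t → toℕ z ≡ t * d → ∣ G ∣ ≡ t * 2
    z≡t*d⇒∣G∣≡t*2 t z≡td = *-cancelʳ-≡ ∣ G ∣ (t * 2) d (begin
      ∣ G ∣ * d      ≡⟨ ∣G∣*d≡n ⟩
      n              ≡⟨ z+z≡n ⟨
      toℕ z + toℕ z  ≡⟨ cong₂ _+_ z≡td z≡td ⟩
      t * d + t * d  ≡⟨ t*d+t*d≡t*2*d t d ⟩
      t * 2 * d      ∎)

    ∣G∣≡t*2⇒z≡t*d : ∀ t → ∣ G ∣ ≡ t * 2 → toℕ z ≡ t * d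
    ∣G∣≡t*2⇒z≡t*d t ∣G∣≡t2 = *-cancelʳ-≡ (toℕ z) (t * d) 2 (begin
      toℕ z * 2      ≡⟨ m*2≡m+m (toℕ z) ⟩
      toℕ z + toℕ z  ≡⟨ z+z≡n ⟩
      n              ≡⟨ ∣G∣*d≡n ⟨
      ∣ G ∣ * d      ≡⟨ cong (_* d) ∣G∣≡t2 ⟩
      t * 2 * d      ≡⟨ swap t d ⟩
      t * d * 2      ∎)
      where
      m*2≡m+m : ∀ m → m * 2 ≡ m + m
      m*2≡m+m = solve-∀
      swap : ∀ t d → t * 2 * d ≡ t * d * 2
      swap = solve-∀

    2∣∣G∣⇒z∈G : 2 ∣ ∣ G ∣ → z ∈ G
    2∣∣G∣⇒z∈G (divides t ∣G∣≡t2) = ∣⇒∈ (divides t (∣G∣≡t*2⇒z≡t*d t ∣G∣≡t2))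

    z∈G⇒2∣∣G∣ : z ∈ G → 2 ∣ ∣ G ∣
    z∈G⇒2∣∣G∣ z∈G with ∈⇒∣ z∈G
    ... | divides t z≡td = divides t (z≡t*d⇒∣G∣≡t*2 t z≡td)

    4∣∣G∣⇒z∈double : 4 ∣ ∣ G ∣ → z ∈ double G
    4∣∣G∣⇒z∈double (divides u ∣G∣≡u4) =
      even-index⇒∈double {i = u * 2} (∣G∣≡t*2⇒z≡t*d (u * 2) (trans ∣G∣≡u4 (u*4≡u*2*2 u))) (divides u refl)
      where
      u*4≡u*2*2 : ∀ u → u * 4 ≡ u * 2 * 2
      u*4≡u*2*2 = solve-∀

    z∈double⇒4∣∣G∣ : z ∈ double G → 4 ∣ ∣ G ∣
    z∈double⇒4∣∣G∣ z∈2G with z∈G⇒2∣∣G∣ (double⊆ G-sg z∈2G)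
    ... | 2∣∣G∣@(divides t ∣G∣≡t2) with ∈double⇒even-index 2∣∣G∣ {i = t} z∈2G (∣G∣≡t*2⇒z≡t*d t ∣G∣≡t2)
    ...   | divides u t≡u2 = divides u (trans ∣G∣≡t2 (trans (cong (_* 2) t≡u2) (u*2*2≡u*4 u)))
      where
      u*2*2≡u*4 : ∀ u → u * 2 * 2 ≡ u * 4
      u*2*2≡u*4 = solve-∀

    z∉G⇒G⊆double : z ∉ G → G ⊆ double G
    z∉G⇒G⊆double z∉G = odd-order⇒⊆double (λ 2∣∣G∣ → z∉G (2∣∣G∣⇒z∈G 2∣∣G∣))

  halves∉ : ∀ {G} → IsSubgroup G → ∀ {h} → h ⊕ h ≡ z → z ∉ G → h ∉ G × z ⊕ h ∉ G
  halves∉ {G} G-sg {h} h⊕h≡z z∉G =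
    double∉⇒∉ G-sg (subst (_∉ G) (sym h⊕h≡z) z∉G) , double∉⇒∉ G-sg (subst (_∉ G) (sym 2[z⊕h]≡z) z∉G)
    where
    2[z⊕h]≡z : (z ⊕ h) ⊕ (z ⊕ h) ≡ z
    2[z⊕h]≡z = begin
      (z ⊕ h) ⊕ (z ⊕ h)  ≡⟨ interchange z h z h ⟩
      (z ⊕ z) ⊕ (h ⊕ h)  ≡⟨ cong (_⊕ (h ⊕ h)) z⊕z≡0 ⟩
      0ₙ ⊕ (h ⊕ h)       ≡⟨ identityˡ (h ⊕ h) ⟩
      h ⊕ h              ≡⟨ h⊕h≡z ⟩
      z                  ∎

-- Parity relative to a subgroup

does-flip : ∀ {A B : Set} (a? : Dec A) (b? : Dec B) → (A → ¬ B) → (¬ A → B) → does b? ≡ not (does a?)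
does-flip (yes a) (yes b) a⇒¬b _    = ⊥-elim (a⇒¬b a b)
does-flip (yes _) (no _)  _    _    = refl
does-flip (no _)  (yes _) _    _    = refl
does-flip (no ¬a) (no ¬b) _    ¬a⇒b = ⊥-elim (¬b (¬a⇒b ¬a))

module Parity {n : ℕ} {{_ : NonZero n}} {G : Subset n} (G-sg : IsSubgroup G) where
  open CyclicSubgroup G-sg
  private
    2G-sg = double-isSubgroup G-sg
    module 2G = IsSubgroup 2G-sg

  representative : Fin n → Fin n
  representative x = [ toℕ x % d ]

  x⊖representative∈G : ∀ x → x ⊖ representative x ∈ G
  x⊖representative∈G x = subst (_∈ G) (sym x⊖r≡) ([*d]∈G (toℕ x / d))
    where
    x≡ : x ≡ representative x ⊕ [ toℕ x / d * d ]
    x≡ = begin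
      x                                        ≡⟨ [toℕ] x ⟨
      [ toℕ x ]                                ≡⟨ cong [_] (m≡m%n+[m/n]*n (toℕ x) d) ⟩
      [ toℕ x % d + toℕ x / d * d ]            ≡⟨ [+] (toℕ x % d) (toℕ x / d * d) ⟨
      representative x ⊕ [ toℕ x / d * d ]     ∎
    x⊖r≡ : x ⊖ representative x ≡ [ toℕ x / d * d ]
    x⊖r≡ = trans (cong (_⊖ representative x) x≡) (xyx⁻¹≈y (representative x) _)

  representative-⊕ : ∀ x {s} → s ∈ G → representative (x ⊕ s) ≡ representative x
  representative-⊕ x {s} s∈G = cong [_] (begin
    toℕ [ toℕ x + toℕ s ] % d    ≡⟨ cong (_% d) (toℕ-[] (toℕ x + toℕ s)) ⟩
    (toℕ x + toℕ s) % n % d      ≡⟨ m∣n⇒o%n%m≡o%m d n (toℕ x + toℕ s) d∣n ⟩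
    (toℕ x + toℕ s) % d          ≡⟨ %-remove-+ʳ (toℕ x) (∈⇒∣ s∈G) ⟩
    toℕ x % d                    ∎)

  -- a Bool suffices because 2G has index at most 2 in G (index-two)
  parity : Fin n → Bool
  parity x = does (x ⊖ representative x ∈? double G)

  ⊕-⊖representative : ∀ x {s} → s ∈ G → (x ⊕ s) ⊖ representative (x ⊕ s) ≡ (x ⊖ representative x) ⊕ s
  ⊕-⊖representative x {s} s∈G = trans (cong ((x ⊕ s) ⊖_) (representative-⊕ x s∈G)) (xy∙z≈xz∙y x s (⊝ representative x))

  parity-double : ∀ x {s} → s ∈ double G → parity (x ⊕ s) ≡ parity x
  parity-double x {s} s∈2G rewrite ⊕-⊖representative x (double⊆ G-sg s∈2G) =
    does-⇔ (mk⇔ (λ u⊕s∈ → ⊕-cancelʳ-∈ 2G-sg u⊕s∈ s∈2G) (λ u∈ → 2G.⊕-closed u∈ s∈2G)) (_ ∈? double G) (_ ∈? double G)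

  parity-odd : ∀ x {s} → s ∈ G ─ double G → parity (x ⊕ s) ≡ not (parity x)
  parity-odd x {s} s∈ with x∈p─q⁻ G (double G) s∈
  ... | s∈G , s∉2G rewrite ⊕-⊖representative x s∈G = does-flip (_ ∈? double G) (_ ∈? double G)
    (λ u∈ u⊕s∈ → s∉2G (⊕-cancelʳ-∈ 2G-sg (subst (_∈ double G) (⊕-comm _ s) u⊕s∈) u∈))
    (λ u∉ → index-two (x∈p∧x∉q⇒x∈p─q (x⊖representative∈G x) u∉) s∈)

-- Cayley graph isomorphisms from involutions

module _ {n : ℕ} {{_ : NonZero n}} where

  involution⇒CayIso : ∀ {S T : Subset n} (f : Fin n → Fin n) → (∀ x → f (f x) ≡ x) →
                      (∀ x y → Adj S x y ⇔ Adj T (f x) (f y)) → CayIso S T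
  involution⇒CayIso f f∘f≡id adj = record { f = ↔⇒⤖ (mk↔ₛ′ f f f∘f≡id f∘f≡id) ; adj = adj }

  involution⇒CayAut : ∀ {S : Subset n} (f : Fin n → Fin n) → (∀ x → f (f x) ≡ x) →
                      (∀ x y → Adj S x y → Adj S (f x) (f y)) → CayAut S
  involution⇒CayAut {S} f f∘f≡id preserves = involution⇒CayIso f f∘f≡id λ x y →
    mk⇔ (preserves x y) (λ adj → subst₂ (Adj S) (f∘f≡id x) (f∘f≡id y) (preserves (f x) (f y) adj))

  module HalfShift (S O : Subset n) (z : Fin n) (z⊕z≡0 : z ⊕ z ≡ 0ₙ) (ε : Fin n → Bool)
                   (ε-z : ∀ x → ε (x ⊕ z) ≡ ε x) (ε-O : ∀ x {s} → s ∈ O → ε (x ⊕ s) ≡ not (ε x))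
                   (O⊕z⊆O : ∀ {s} → s ∈ O → s ⊕ z ∈ O) (S⊕z⊆S∪O : ∀ {s} → s ∈ S → s ∉ O → s ⊕ z ∈ S ∪ O) where

    shiftIf : Bool → Fin n
    shiftIf true  = z
    shiftIf false = 0ₙ

    f : Fin n → Fin n
    f x = x ⊕ shiftIf (ε x)

    ε-shiftIf : ∀ x b → ε (x ⊕ shiftIf b) ≡ ε x
    ε-shiftIf x true  = ε-z x
    ε-shiftIf x false = cong ε (identityʳ x)

    shiftIf-selfInverse : ∀ b → shiftIf b ⊕ shiftIf b ≡ 0ₙ
    shiftIf-selfInverse true  = z⊕z≡0
    shiftIf-selfInverse false = identityʳ 0ₙ

    f-involutive : ∀ x → f (f x) ≡ x
    f-involutive x = begin
      f x ⊕ shiftIf (ε (f x))                ≡⟨ cong (λ b → f x ⊕ shiftIf b) (ε-shiftIf x (ε x)) ⟩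
      (x ⊕ shiftIf (ε x)) ⊕ shiftIf (ε x)    ≡⟨ ⊕-assoc x _ _ ⟩
      x ⊕ (shiftIf (ε x) ⊕ shiftIf (ε x))    ≡⟨ cong (x ⊕_) (shiftIf-selfInverse (ε x)) ⟩
      x ⊕ 0ₙ                                 ≡⟨ identityʳ x ⟩
      x                                      ∎

    ⊝z≡z : ⊝ z ≡ z
    ⊝z≡z = sym (inverseʳ-unique z z z⊕z≡0)

    ⊕z⊕z : ∀ u → (u ⊕ z) ⊕ z ≡ u
    ⊕z⊕z u = trans (⊕-assoc u z z) (trans (cong (u ⊕_) z⊕z≡0) (identityʳ u))

    ∉O⇒⊕z∉O : ∀ {u} → u ∉ O → u ⊕ z ∉ O
    ∉O⇒⊕z∉O {u} u∉O u⊕z∈O = u∉O (subst (_∈ O) (⊕z⊕z u) (O⊕z⊆O u⊕z∈O))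

    S⊕z⊆S : ∀ {s} → s ∈ S → s ∉ O → s ⊕ z ∈ S
    S⊕z⊆S s∈S s∉O with x∈p∪q⁻ S O (S⊕z⊆S∪O s∈S s∉O)
    ... | inj₁ s⊕z∈S = s⊕z∈S
    ... | inj₂ s⊕z∈O = ⊥-elim (∉O⇒⊕z∉O s∉O s⊕z∈O)

    ∈S⇔⊕z∈S : ∀ {u} → u ∉ O → u ∈ S ⇔ u ⊕ z ∈ S
    ∈S⇔⊕z∈S {u} u∉O = mk⇔ (λ u∈S → S⊕z⊆S u∈S u∉O) λ u⊕z∈S →
      subst (_∈ S) (⊕z⊕z u) (S⊕z⊆S u⊕z∈S (∉O⇒⊕z∉O u∉O))

    ∈S⇔⊕0∈S : ∀ u → u ∈ S ⇔ u ⊕ 0ₙ ∈ S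
    ∈S⇔⊕0∈S u = mk⇔ (subst (_∈ S) (sym (identityʳ u))) (subst (_∈ S) (identityʳ u))

    f-difference : ∀ x y → (f y ⊖ f x) ⊖ z ≡ (y ⊖ x) ⊕ ((shiftIf (ε y) ⊖ shiftIf (ε x)) ⊕ z)
    f-difference x y = begin
      ((y ⊕ b) ⊖ (x ⊕ a)) ⊖ z            ≡⟨ cong (((y ⊕ b) ⊖ (x ⊕ a)) ⊕_) ⊝z≡z ⟩
      ((y ⊕ b) ⊖ (x ⊕ a)) ⊕ z            ≡⟨ cong (_⊕ z) (⊕-⊖-interchange y b x a) ⟩
      ((y ⊖ x) ⊕ (b ⊖ a)) ⊕ z            ≡⟨ ⊕-assoc (y ⊖ x) (b ⊖ a) z ⟩
      (y ⊖ x) ⊕ ((b ⊖ a) ⊕ z)            ∎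
      where
      a = shiftIf (ε x)
      b = shiftIf (ε y)

    shiftIf-difference : ∀ a b → (shiftIf b ⊖ shiftIf a) ⊕ z ≡ shiftIf (not (a xor b))
    shiftIf-difference true  true  = //-rightDividesˡ z z
    shiftIf-difference false false = trans (cong (_⊕ z) (inverseʳ 0ₙ)) (identityˡ z)
    shiftIf-difference true  false = //-rightDividesˡ z 0ₙ
    shiftIf-difference false true  = trans (cong (_⊕ z) (trans (cong (z ⊕_) ε⁻¹≈ε) (identityʳ z))) z⊕z≡0

    adjacency : ∀ u a b → (a ≡ b → u ∉ O) → u ∈ S ⇔ u ⊕ ((shiftIf b ⊖ shiftIf a) ⊕ z) ∈ S
    adjacency u a b same = subst (λ w → u ∈ S ⇔ u ⊕ w ∈ S) (sym (shiftIf-difference a b)) (by-cases a b same)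
      where
      by-cases : ∀ a b → (a ≡ b → u ∉ O) → u ∈ S ⇔ u ⊕ shiftIf (not (a xor b)) ∈ S
      by-cases true  true  same = ∈S⇔⊕z∈S (same refl)
      by-cases false false same = ∈S⇔⊕z∈S (same refl)
      by-cases true  false _    = ∈S⇔⊕0∈S u
      by-cases false true  _    = ∈S⇔⊕0∈S u

    same-parity⇒∉O : ∀ x y → ε x ≡ ε y → y ⊖ x ∉ O
    same-parity⇒∉O x y εx≡εy y⊖x∈O = not-¬ refl (trans εx≡εy (trans (cong ε (sym x⊕[y⊖x]≡y)) (ε-O x y⊖x∈O)))
      where
      x⊕[y⊖x]≡y : x ⊕ (y ⊖ x) ≡ y
      x⊕[y⊖x]≡y = trans (sym (⊕-assoc x y (⊝ x))) (xyx⁻¹≈y x y)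

    iso : CayIso S (translate S z)
    iso = involution⇒CayIso f f-involutive λ x y →
      let S⇔ = adjacency (y ⊖ x) (ε x) (ε y) (same-parity⇒∉O x y) in
      mk⇔ (λ y⊖x∈S → x∈translate⁺ z (subst (_∈ S) (sym (f-difference x y)) (Equivalence.to S⇔ y⊖x∈S)))
          (λ fy⊖fx∈S+z → Equivalence.from S⇔ (subst (_∈ S) (f-difference x y) (x∈translate⁻ z fy⊖fx∈S+z)))

module _ {n : ℕ} {{_ : NonZero n}} where

  module CosetSwap (K H T : Subset n) (K-sg : IsSubgroup K) (H-sg : IsSubgroup H)
                   (a h : Fin n) (h∈H : h ∈ H) (a∉K : a ∉ K) (h∉K : h ∉ K) (a⊕h∉K : a ⊕ h ∉ K)
                   (T-closed : ∀ {t e} → t ∈ T → t ∉ K → e ∈ H → t ⊕ e ∈ T ⊎ t ⊕ e ∈ K) where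
    open IsSubgroup K-sg using (0∈H; ⊝-closed)
    module H = IsSubgroup H-sg

    A B : Subset n
    A = translate K a
    B = translate K (a ⊕ h)

    pick : Bool → Bool → Fin n
    pick true  _     = h
    pick false true  = ⊝ h
    pick false false = 0ₙ

    c : Fin n → Fin n
    c x = pick (does (x ∈? A)) (does (x ∈? B))

    φ : Fin n → Fin n
    φ x = x ⊕ c x

    pick∈H : ∀ b b′ → pick b b′ ∈ H
    pick∈H true  _     = h∈H
    pick∈H false true  = H.⊝-closed h∈H
    pick∈H false false = H.0∈H

    c-coset : ∀ x y → y ⊖ x ∈ K → c y ≡ c x
    c-coset x y y⊖x∈K = cong₂ pick (coset-invariant a) (coset-invariant (a ⊕ h))
      where
      x⊖y∈K = subst (_∈ K) (⁻¹-anti-homo-// y x) (⊝-closed y⊖x∈K)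
      coset-invariant : ∀ g → does (y ∈? translate K g) ≡ does (x ∈? translate K g)
      coset-invariant g = does-⇔ (mk⇔ (coset-step K-sg g x⊖y∈K) (coset-step K-sg g y⊖x∈K)) (y ∈? translate K g) (x ∈? translate K g)

    φ-A : ∀ {x} → x ∈ A → φ x ≡ x ⊕ h
    φ-A {x} x∈A = cong (λ b → x ⊕ pick b (does (x ∈? B))) (dec-true (x ∈? A) x∈A)

    φ-B : ∀ {x} → x ∉ A → x ∈ B → φ x ≡ x ⊖ h
    φ-B {x} x∉A x∈B = cong (x ⊕_) (cong₂ pick (dec-false (x ∈? A) x∉A) (dec-true (x ∈? B) x∈B))

    φ-other : ∀ {x} → x ∉ A → x ∉ B → φ x ≡ x
    φ-other {x} x∉A x∉B = trans (cong (x ⊕_) (cong₂ pick (dec-false (x ∈? A) x∉A) (dec-false (x ∈? B) x∉B))) (identityʳ x)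

    c∈H : ∀ x → c x ∈ H
    c∈H x = pick∈H (does (x ∈? A)) (does (x ∈? B))

    x∈A⇒x⊕h∉A : ∀ {x} → x ∈ A → x ⊕ h ∉ A
    x∈A⇒x⊕h∉A {x} x∈A x⊕h∈A = h∉K (subst (_∈ K) (xyx⁻¹≈y x h) (coset-difference K-sg a x∈A x⊕h∈A))

    φ-involutive : ∀ x → φ (φ x) ≡ x
    φ-involutive x = by-cases (x ∈? A) (x ∈? B)
      where
      by-cases : Dec (x ∈ A) → Dec (x ∈ B) → φ (φ x) ≡ x
      by-cases (yes x∈A) _ = begin
        φ (φ x)      ≡⟨ cong φ (φ-A x∈A) ⟩
        φ (x ⊕ h)    ≡⟨ φ-B (x∈A⇒x⊕h∉A x∈A) (x∈translate-⊕ {A = K} a h x∈A) ⟩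
        (x ⊕ h) ⊖ h  ≡⟨ //-rightDividesʳ h x ⟩
        x            ∎
      by-cases (no x∉A) (yes x∈B) = begin
        φ (φ x)      ≡⟨ cong φ (φ-B x∉A x∈B) ⟩
        φ (x ⊖ h)    ≡⟨ φ-A (x∈translate-⊕⁻ {A = K} a h (subst (_∈ B) (sym (//-rightDividesˡ h x)) x∈B)) ⟩
        (x ⊖ h) ⊕ h  ≡⟨ //-rightDividesˡ h x ⟩
        x            ∎
      by-cases (no x∉A) (no x∉B) = trans (cong φ (φ-other x∉A x∉B)) (φ-other x∉A x∉B)

    φ-difference : ∀ x y → φ y ⊖ φ x ≡ (y ⊖ x) ⊕ (c y ⊖ c x)
    φ-difference x y = ⊕-⊖-interchange y (c y) x (c x)

    φ-coset : ∀ x y → y ⊖ x ∈ K → φ y ⊖ φ x ≡ y ⊖ x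
    φ-coset x y y⊖x∈K = begin
      φ y ⊖ φ x                ≡⟨ φ-difference x y ⟩
      (y ⊖ x) ⊕ (c y ⊖ c x)    ≡⟨ cong (λ w → (y ⊖ x) ⊕ (w ⊖ c x)) (c-coset x y y⊖x∈K) ⟩
      (y ⊖ x) ⊕ (c x ⊖ c x)    ≡⟨ cong ((y ⊖ x) ⊕_) (inverseʳ (c x)) ⟩
      (y ⊖ x) ⊕ 0ₙ             ≡⟨ identityʳ (y ⊖ x) ⟩
      y ⊖ x                    ∎

    φ-reflects-K : ∀ x y → φ y ⊖ φ x ∈ K → y ⊖ x ∈ K
    φ-reflects-K x y φy⊖φx∈K =
      subst (_∈ K) (trans (sym (φ-coset (φ x) (φ y) φy⊖φx∈K)) (cong₂ _⊖_ (φ-involutive y) (φ-involutive x))) φy⊖φx∈K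

    φ-preserves : ∀ x y → Adj T x y → Adj T (φ x) (φ y)
    φ-preserves x y y⊖x∈T with y ⊖ x ∈? K
    ... | yes y⊖x∈K = subst (_∈ T) (sym (φ-coset x y y⊖x∈K)) y⊖x∈T
    ... | no y⊖x∉K with T-closed y⊖x∈T y⊖x∉K (⊖-closed H-sg (c∈H y) (c∈H x))
    ...   | inj₁ ∈T = subst (_∈ T) (sym (φ-difference x y)) ∈T
    ...   | inj₂ ∈K = ⊥-elim (y⊖x∉K (φ-reflects-K x y (subst (_∈ K) (sym (φ-difference x y)) ∈K)))

    aut : CayAut T
    aut = involution⇒CayAut φ φ-involutive φ-preserves

    φ-0 : φ 0ₙ ≡ 0ₙ
    φ-0 = φ-other (a∉K ∘ 0∈coset⇒∈ K-sg a) (a⊕h∉K ∘ 0∈coset⇒∈ K-sg (a ⊕ h))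

    φ-a : φ a ≢ a
    φ-a φa≡a = h∉K (subst (_∈ K) (sym (identityʳ-unique a h (trans (sym (φ-A (∈coset-self K-sg a))) φa≡a))) 0∈H)

module _ {n : ℕ} {{_ : NonZero n}} {K H : Subset n} (K-sg : IsSubgroup K) (H-sg : IsSubgroup H) where
  private
    module K = IsSubgroup K-sg
    module H = IsSubgroup H-sg

  ∈double-sumset⇒∈double : (∀ {e} → e ∈ H → e ⊕ e ∈ K → e ⊕ e ∈ double K) →
                           ∀ {x} → x ∈ K → x ∈ double (sumset K H) → x ∈ double K
  ∈double-sumset⇒∈double 2H∩K⊆2K {x} x∈K x∈2L with x∈double⁻ (sumset K H) x∈2L
  ... | b , b∈L , x≡2b with x∈sumset⁻ K H b∈L
  ...   | c , e , c∈K , e∈H , b≡c⊕e =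
    subst (_∈ double K) (sym x≡2c⊕2e) (IsSubgroup.⊕-closed (double-isSubgroup K-sg) (a⊕a∈double c∈K) 2e∈2K)
    where
    x≡2c⊕2e : x ≡ (c ⊕ c) ⊕ (e ⊕ e)
    x≡2c⊕2e = trans x≡2b (trans (cong (λ y → y ⊕ y) b≡c⊕e) (interchange c e c e))
    2e∈2K : e ⊕ e ∈ double K
    2e∈2K = 2H∩K⊆2K e∈H
      (⊕-cancelʳ-∈ K-sg (subst (_∈ K) (trans x≡2c⊕2e (⊕-comm (c ⊕ c) (e ⊕ e))) x∈K) (K.⊕-closed c∈K c∈K))

  -- if c + e = 2c' + 2e', then w = c - 2c' = 2e' - e lies in H ∩ K, hence in 2K, and so c ∈ 2K
  Ko+H⊆Lo : Empty (H ∩ (K ─ double K)) → sumset (K ─ double K) H ⊆ sumset K H ─ double (sumset K H)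
  Ko+H⊆Lo H∩Ko≡∅ s∈ with x∈sumset⁻ (K ─ double K) H s∈
  ... | c , e , c∈Ko , e∈H , s≡c⊕e with x∈p─q⁻ K (double K) c∈Ko
  ...   | c∈K , c∉2K = x∈p∧x∉q⇒x∈p─q (subst (_∈ sumset K H) (sym s≡c⊕e) (a⊕b∈sumset c∈K e∈H)) s∉2L
    where
    s∉2L : _ ∉ double (sumset K H)
    s∉2L s∈2L with x∈double⁻ (sumset K H) s∈2L
    ... | b , b∈L , s≡2b with x∈sumset⁻ K H b∈L
    ...   | c′ , e′ , c′∈K , e′∈H , b≡c′⊕e′ =
      c∉2K (subst (_∈ double K) (//-rightDividesˡ (c′ ⊕ c′) c) (2K.⊕-closed w∈2K (a⊕a∈double c′∈K)))
      where
      module 2K = IsSubgroup (double-isSubgroup K-sg)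
      c⊕e≡ : c ⊕ e ≡ (c′ ⊕ c′) ⊕ (e′ ⊕ e′)
      c⊕e≡ = trans (sym s≡c⊕e) (trans s≡2b (trans (cong (λ y → y ⊕ y) b≡c′⊕e′) (interchange c′ e′ c′ e′)))
      w∈K : c ⊖ (c′ ⊕ c′) ∈ K
      w∈K = ⊖-closed K-sg c∈K (K.⊕-closed c′∈K c′∈K)
      w∈H : c ⊖ (c′ ⊕ c′) ∈ H
      w∈H = subst (_∈ H) (sym (⊕≡⊕⇒⊖≡⊖ c⊕e≡)) (⊖-closed H-sg (H.⊕-closed e′∈H e′∈H) e∈H)
      w∈2K : c ⊖ (c′ ⊕ c′) ∈ double K
      w∈2K = decidable-stable (_ ∈? double K) λ w∉2K → H∩Ko≡∅ (_ , x∈p∩q⁺ (w∈H , x∈p∧x∉q⇒x∈p─q w∈K w∉2K))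

module Lemma7p6 {n : ℕ} {{_ : NonZero n}} (z : Fin n) (z+z≡n : toℕ z + toℕ z ≡ n)
               (S H K : Subset n) (H-sg : IsSubgroup H) (K-sg : IsSubgroup K) (2∣∣K∣ : 2 ∣ ∣ K ∣) where
  open Half z z+z≡n
  private
    module H = IsSubgroup H-sg
    module K = IsSubgroup K-sg

  Ko L Lo : Subset n
  Ko = K ─ double K
  L  = sumset K H
  Lo = L ─ double L

  Hypothesis₁ Hypothesis₂ : Set
  Hypothesis₁ = (sumset S H ⊆ (S ∪ sumset Ko H)) × Empty (H ∩ Ko)
  Hypothesis₂ = (sumset (S ─ Ko) H ⊆ (S ∪ Ko)) × (∣ H ∣ ≢ 2 ⊎ 4 ∣ ∣ K ∣)

  L-sg  = sumset-isSubgroup K-sg H-sg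
  2K-sg = double-isSubgroup K-sg
  2H-sg = double-isSubgroup H-sg

  z∈K : z ∈ K
  z∈K = 2∣∣G∣⇒z∈G K-sg 2∣∣K∣

  K⊆L : K ⊆ L
  K⊆L = ⊆sumsetˡ H.0∈H

  H⊆L : H ⊆ L
  H⊆L = ⊆sumsetʳ K.0∈H

  -- x = 2c + 2e forces 2e ∈ 2H ∩ K, a subgroup without z, so 2e ∈ 2(2H ∩ K) ⊆ 2K
  Ko⊆Lo : z ∉ double H → Ko ⊆ Lo
  Ko⊆Lo z∉2H {x} x∈Ko with x∈p─q⁻ K (double K) x∈Ko
  ... | x∈K , x∉2K = x∈p∧x∉q⇒x∈p─q (K⊆L x∈K) (x∉2K ∘ ∈double-sumset⇒∈double K-sg H-sg 2e∈K⇒2e∈2K x∈K)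
    where
    2e∈K⇒2e∈2K : ∀ {e} → e ∈ H → e ⊕ e ∈ K → e ⊕ e ∈ double K
    2e∈K⇒2e∈2K e∈H 2e∈K = double-mono (proj₂ ∘ x∈p∩q⁻ (double H) K)
      (z∉G⇒G⊆double (∩-isSubgroup 2H-sg K-sg) (z∉2H ∘ proj₁ ∘ x∈p∩q⁻ (double H) K) (x∈p∩q⁺ (a⊕a∈double e∈H , 2e∈K)))

  Lo-stable : ∀ {B} → B ⊆ double L → 0ₙ ∈ B → (∀ {a b} → a ∈ S ─ Lo → b ∈ B → a ⊕ b ∈ S ∪ Lo) →
              sumset (S ─ Lo) B ≡ S ─ Lo
  Lo-stable B⊆2L 0∈B = sumset-─-stable 0∈B (λ x⊕b∈Lo b∈B → ─double-⊕⁻ L-sg x⊕b∈Lo (B⊆2L b∈B))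

  Hypothesis₁⇒S+H⊆S∪Lo : Hypothesis₁ → Ko ⊆ Lo → H ⊆ double L → ∀ {a b} → a ∈ S ─ Lo → b ∈ H → a ⊕ b ∈ S ∪ Lo
  Hypothesis₁⇒S+H⊆S∪Lo (S+H⊆ , _) Ko⊆Lo H⊆2L a∈ b∈H
    with x∈p∪q⁻ S (sumset Ko H) (S+H⊆ (a⊕b∈sumset (p─q⊆p S Lo a∈) b∈H))
  ... | inj₁ a⊕b∈S    = x∈p∪q⁺ (inj₁ a⊕b∈S)
  ... | inj₂ a⊕b∈Ko+H with x∈sumset⁻ Ko H a⊕b∈Ko+H
  ...   | c , e , c∈Ko , e∈H , a⊕b≡c⊕e =
    x∈p∪q⁺ (inj₂ (subst (_∈ Lo) (sym a⊕b≡c⊕e) (─double-⊕ L-sg (Ko⊆Lo c∈Ko) (H⊆2L e∈H))))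

  Hypothesis₂⇒S+H⊆S∪Lo : sumset (S ─ Ko) H ⊆ S ∪ Ko → Ko ⊆ Lo → ∀ {a b} → a ∈ S ─ Lo → b ∈ H → a ⊕ b ∈ S ∪ Lo
  Hypothesis₂⇒S+H⊆S∪Lo S+H⊆ Ko⊆Lo a∈ b∈H with x∈p─q⁻ S Lo a∈
  ... | a∈S , a∉Lo with x∈p∪q⁻ S Ko (S+H⊆ (a⊕b∈sumset (x∈p∧x∉q⇒x∈p─q a∈S (a∉Lo ∘ Ko⊆Lo)) b∈H))
  ...   | inj₁ a⊕b∈S  = x∈p∪q⁺ (inj₁ a⊕b∈S)
  ...   | inj₂ a⊕b∈Ko = x∈p∪q⁺ (inj₂ (Ko⊆Lo a⊕b∈Ko))

  z∉H─Ko⇒z∈Ko : z ∈ H → z ∉ H ─ Ko → z ∈ Ko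
  z∉H─Ko⇒z∈Ko z∈H z∉H─Ko = decidable-stable (z ∈? Ko) (z∉H─Ko ∘ x∈p∧x∉q⇒x∈p─q z∈H)

  z∈Ko⇒Hypothesis₂ : z ∈ H → z ∈ Ko → Hypothesis₁ ⊎ Hypothesis₂ → Hypothesis₂
  z∈Ko⇒Hypothesis₂ z∈H z∈Ko (inj₁ (_ , H∩Ko≡∅)) = ⊥-elim (H∩Ko≡∅ (z , x∈p∩q⁺ (z∈H , z∈Ko)))
  z∈Ko⇒Hypothesis₂ _      _       (inj₂ hyp₂)           = hyp₂

  part-i : Hypothesis₁ ⊎ Hypothesis₂ → ¬ 2 ∣ ∣ H ∣ → sumset (S ─ Lo) H ≡ S ─ Lo
  part-i hyp odd = Lo-stable H⊆2L H.0∈H (S+H⊆S∪Lo hyp)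
    where
    z∉H : z ∉ H
    z∉H = odd ∘ z∈G⇒2∣∣G∣ H-sg
    H⊆2L : H ⊆ double L
    H⊆2L = double-mono H⊆L ∘ z∉G⇒G⊆double H-sg z∉H
    Ko⊆Lo′ : Ko ⊆ Lo
    Ko⊆Lo′ = Ko⊆Lo (z∉H ∘ double⊆ H-sg)
    S+H⊆S∪Lo : Hypothesis₁ ⊎ Hypothesis₂ → ∀ {a b} → a ∈ S ─ Lo → b ∈ H → a ⊕ b ∈ S ∪ Lo
    S+H⊆S∪Lo (inj₁ hyp₁)     = Hypothesis₁⇒S+H⊆S∪Lo hyp₁ Ko⊆Lo′ H⊆2L
    S+H⊆S∪Lo (inj₂ (S+H⊆ , _)) = Hypothesis₂⇒S+H⊆S∪Lo S+H⊆ Ko⊆Lo′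

  part-ii : Hypothesis₁ ⊎ Hypothesis₂ → 2 ∣ ∣ H ∣ → ¬ 4 ∣ ∣ H ∣ → z ∉ H ─ Ko →
            (∣ H ∣ > 2) × (sumset (S ─ Lo) (double H) ≡ S ─ Lo)
  part-ii hyp 2∣∣H∣ ¬4∣∣H∣ z∉H─Ko =
    even∧≢2⇒>2 2∣∣H∣ (≤-<-trans z≤n (x∈p⇒∣p-x∣<∣p∣ H.0∈H)) ∣H∣≢2 ,
    Lo-stable (double-mono H⊆L) (IsSubgroup.0∈H 2H-sg) 2H-closed
    where
    z∈H = 2∣∣G∣⇒z∈G H-sg 2∣∣H∣
    z∈Ko = z∉H─Ko⇒z∈Ko z∈H z∉H─Ko
    hyp₂ = z∈Ko⇒Hypothesis₂ z∈H z∈Ko hyp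
    ∣H∣≢2 : ∣ H ∣ ≢ 2
    ∣H∣≢2 with proj₂ hyp₂
    ... | inj₁ ∣H∣≢2 = ∣H∣≢2
    ... | inj₂ 4∣∣K∣ = ⊥-elim (x∈p─q⇒x∉q K (double K) z∈Ko (4∣∣G∣⇒z∈double K-sg 4∣∣K∣))
    2H-closed : ∀ {a b} → a ∈ S ─ Lo → b ∈ double H → a ⊕ b ∈ S ∪ Lo
    2H-closed a∈ b∈2H =
      Hypothesis₂⇒S+H⊆S∪Lo (proj₁ hyp₂) (Ko⊆Lo (¬4∣∣H∣ ∘ z∈double⇒4∣∣G∣ H-sg)) a∈ (double⊆ H-sg b∈2H)

  part-iii : Hypothesis₁ ⊎ Hypothesis₂ → z ∈ H ─ Ko → CayIso S (translate S z)
  part-iii hyp z∈H─Ko with x∈p─q⁻ H Ko z∈H─Ko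
  ... | z∈H , z∉Ko = by-hypothesis hyp
    where
    z∈2K : z ∈ double K
    z∈2K = decidable-stable (z ∈? double K) (z∉Ko ∘ x∈p∧x∉q⇒x∈p─q z∈K)
    by-hypothesis : Hypothesis₁ ⊎ Hypothesis₂ → CayIso S (translate S z)
    by-hypothesis (inj₂ (S─Ko+H⊆ , _)) =
      HalfShift.iso S Ko z z⊕z≡0 parity (λ x → parity-double x z∈2K) parity-odd
        (λ s∈Ko → ─double-⊕ K-sg s∈Ko z∈2K)
        (λ s∈S s∉Ko → S─Ko+H⊆ (a⊕b∈sumset (x∈p∧x∉q⇒x∈p─q s∈S s∉Ko) z∈H))
      where open Parity K-sg
    by-hypothesis (inj₁ (S+H⊆ , H∩Ko≡∅)) =
      HalfShift.iso S (sumset Ko H) z z⊕z≡0 parity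
        (λ x → parity-double x (double-mono K⊆L z∈2K)) (λ x → parity-odd x ∘ Ko+H⊆Lo K-sg H-sg H∩Ko≡∅)
        Ko+H+z⊆Ko+H (λ s∈S _ → S+H⊆ (a⊕b∈sumset s∈S z∈H))
      where
      open Parity L-sg
      Ko+H+z⊆Ko+H : ∀ {s} → s ∈ sumset Ko H → s ⊕ z ∈ sumset Ko H
      Ko+H+z⊆Ko+H s∈ with x∈sumset⁻ Ko H s∈
      ... | c , e , c∈Ko , e∈H , s≡c⊕e =
        subst (_∈ sumset Ko H) (trans (sym (⊕-assoc c e z)) (cong (_⊕ z) (sym s≡c⊕e))) (a⊕b∈sumset c∈Ko (H.⊕-closed e∈H z∈H))

  S─z+z-closed : sumset (S ─ Ko) H ⊆ S ∪ Ko → z ∈ Ko →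
                 ∀ {t e} → t ∈ translate (S ─ ⁅ z ⁆) z → t ∉ double K → e ∈ H →
                 t ⊕ e ∈ translate (S ─ ⁅ z ⁆) z ⊎ t ⊕ e ∈ double K
  S─z+z-closed S─Ko+H⊆ z∈Ko {t} {e} t∈T t∉2K e∈H =
    [ via-S , via-Ko ]′ (x∈p∪q⁻ S Ko (S─Ko+H⊆ (a⊕b∈sumset (x∈p∧x∉q⇒x∈p─q s∈S s∉Ko) e∈H)))
    where
    open CyclicSubgroup K-sg using (index-two)
    s = t ⊖ z
    s∈S : s ∈ S
    s∈S = p─q⊆p S ⁅ z ⁆ (x∈translate⁻ z t∈T)
    s∉Ko : s ∉ Ko
    s∉Ko s∈Ko = t∉2K (subst (_∈ double K) (//-rightDividesˡ z t) (index-two s∈Ko z∈Ko))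
    [t⊕e]⊖z≡s⊕e : (t ⊕ e) ⊖ z ≡ s ⊕ e
    [t⊕e]⊖z≡s⊕e = xy∙z≈xz∙y t e (⊝ z)
    t⊕e≡[s⊕e]⊕z : t ⊕ e ≡ (s ⊕ e) ⊕ z
    t⊕e≡[s⊕e]⊕z = trans (sym (//-rightDividesˡ z (t ⊕ e))) (cong (_⊕ z) [t⊕e]⊖z≡s⊕e)
    via-Ko : s ⊕ e ∈ Ko → t ⊕ e ∈ translate (S ─ ⁅ z ⁆) z ⊎ t ⊕ e ∈ double K
    via-Ko s⊕e∈Ko = inj₂ (subst (_∈ double K) (sym t⊕e≡[s⊕e]⊕z) (index-two s⊕e∈Ko z∈Ko))
    via-S : s ⊕ e ∈ S → t ⊕ e ∈ translate (S ─ ⁅ z ⁆) z ⊎ t ⊕ e ∈ double K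
    via-S s⊕e∈S with s ⊕ e ≟ z
    ... | yes s⊕e≡z = inj₂ (subst (_∈ double K) (sym (trans t⊕e≡[s⊕e]⊕z (trans (cong (_⊕ z) s⊕e≡z) z⊕z≡0)))
                                 (IsSubgroup.0∈H 2K-sg))
    ... | no  s⊕e≢z = inj₁ (x∈translate⁺ z (subst (_∈ S ─ ⁅ z ⁆) (sym [t⊕e]⊖z≡s⊕e)
                                                   (x∈p∧x∉q⇒x∈p─q s⊕e∈S (x≢y⇒x∉⁅y⁆ s⊕e≢z))))

  part-iv : Hypothesis₁ ⊎ Hypothesis₂ → 4 ∣ ∣ H ∣ → z ∉ H ─ Ko →
            ∃ λ (φ : CayAut (translate (S ─ ⁅ z ⁆) z)) →
              (Bijection.to (CayIso.f φ) 0ₙ ≡ 0ₙ) × (Bijection.to (CayIso.f φ) z ≢ z)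
  part-iv hyp 4∣∣H∣ z∉H─Ko with x∈double⁻ H (4∣∣G∣⇒z∈double H-sg 4∣∣H∣)
  ... | h , h∈H , z≡h⊕h = aut , φ-0 , φ-a
    where
    z∈H  = subst (_∈ H) (sym z≡h⊕h) (H.⊕-closed h∈H h∈H)
    z∈Ko = z∉H─Ko⇒z∈Ko z∈H z∉H─Ko
    z∉2K = x∈p─q⇒x∉q K (double K) z∈Ko
    h∉2K×z⊕h∉2K = halves∉ 2K-sg (sym z≡h⊕h) z∉2K
    open CosetSwap (double K) H (translate (S ─ ⁅ z ⁆) z) 2K-sg H-sg z h h∈H z∉2K (proj₁ h∉2K×z⊕h∉2K) (proj₂ h∉2K×z⊕h∉2K)
                   (S─z+z-closed (proj₁ (z∈Ko⇒Hypothesis₂ z∈H z∈Ko hyp)) z∈Ko)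

lemma7p6 :
  -- m = suc k ranges over the positive integers
  (k : ℕ) → let m = suc k in
  (S H K : Subset (m + m)) →
  -- S is a connection set: inverse-closed and 0 ∉ S
  (∀ {x} → x ∈ S → (⊝ x) ∈ S) → 0ₙ ∉ S →
  IsSubgroup H → Nontrivial H →
  IsSubgroup K → Nontrivial K →
  2 ∣ ∣ K ∣ →
  let Ko = K ─ double K
      L = sumset K H
      Lo = L ─ double L
  in
  ((sumset S H ⊆ (S ∪ sumset Ko H)) × Empty (H ∩ Ko))
    ⊎ ((sumset (S ─ Ko) H ⊆ (S ∪ Ko)) × (∣ H ∣ ≢ 2 ⊎ 4 ∣ ∣ K ∣)) →
  -- (i)
  ((¬ 2 ∣ ∣ H ∣) → sumset (S ─ Lo) H ≡ S ─ Lo)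
  -- (ii)
  × (2 ∣ ∣ H ∣ → ¬ 4 ∣ ∣ H ∣ → half m ∉ (H ─ Ko) →
      (∣ H ∣ > 2) × (sumset (S ─ Lo) (double H) ≡ S ─ Lo))
  -- (iii)
  × (half m ∈ (H ─ Ko) → CayIso S (translate S (half m)))
  -- (iv)
  × (4 ∣ ∣ H ∣ → half m ∉ (H ─ Ko) →
      ∃ λ (φ : CayAut (translate (S ─ ⁅ half m ⁆) (half m))) →
        (Bijection.to (CayIso.f φ) 0ₙ ≡ 0ₙ)
        × (Bijection.to (CayIso.f φ) (half m) ≢ half m))
lemma7p6 k S H K _ _ H-sg _ K-sg _ 2∣∣K∣ hyp = part-i hyp , part-ii hyp , part-iii hyp , part-iv hyp
  where open Lemma7p6 (half (suc k)) (cong₂ _+_ (toℕ-half k) (toℕ-half k)) S H K H-sg K-sg 2∣∣K∣
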